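{- Let $\Delta$ and $T$ be natural numbers with $\Delta\le T$. Then (1) there are exactly $2\Delta-1$ different $\Delta$-templates with respect to lifetime $T$; and (2) every time slot in $[T]$ is covered by exactly $\Delta$ different $\Delta$-templates.
   Context: $[i,j]=\{i,\dots,j\}$, $[T]=[1,T]$. For $t\in[T-\Delta+1]$, the $\Delta$-window $W_t$ is the interval $[t,t+\Delta-1]$. A partial $\Delta$-window (with respect to $T$) is an interval of length at most $\Delta-1$ contained in $[T]$ that either starts at $1$ or ends at $T$. The distance between disjoint intervals $[a_1,b_1],[a_2,b_2]$ with $b_1<a_2$ is $a_2-b_1-1$. A $\Delta$-template with respect to lifetime $T$ is a maximal family $\mathcal S$ of $\Delta$-windows or partial $\Delta$-windows in $[T]$ such that any two consecutive elements of $\mathcal S$ are at distance exactly $\Delta-1$. A time slot $t$ is covered by $\mathcal S$ if $t$ belongs to some interval of $\mathcal S$. -}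

module Defs where

open import Data.Nat using (ℕ; _+_; _≤_; _<_)
open import Data.Product using (_×_; _,_; Σ; proj₁; proj₂)
open import Data.Sum using (_⊎_)
open import Data.List using (List; length)
open import Data.List.Membership.Propositional using (_∈_)
open import Data.List.Relation.Unary.All using (All)
open import Data.List.Relation.Unary.Any using (Any)
open import Data.List.Relation.Unary.Linked using (Linked)
open import Data.List.Relation.Unary.Unique.Propositional using (Unique)
open import Data.List.Relation.Binary.Subset.Propositional using (_⊆_)
open import Function.Bundles using (_⇔_)
open import Relation.Binary.PropositionalEquality using (_≡_)

-- An interval [a,b] is represented by the pair (a , b).
Interval : Set
Interval = ℕ × ℕ

-- [a,b] is the Δ-window W_a = [a, a+Δ-1] with a ∈ [T-Δ+1]:
-- 1 ≤ a, b + 1 = a + Δ, b ≤ T.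
IsWindow : ℕ → ℕ → Interval → Set
IsWindow Δ T (a , b) = 1 ≤ a × b + 1 ≡ a + Δ × b ≤ T

-- [a,b] is a partial Δ-window w.r.t. T: a nonempty interval contained in [T]
-- of length b-a+1 ≤ Δ-1 (i.e. b + 2 ≤ a + Δ) that starts at 1 or ends at T.
IsPartialWindow : ℕ → ℕ → Interval → Set
IsPartialWindow Δ T (a , b) =
  1 ≤ a × a ≤ b × b ≤ T × b + 2 ≤ a + Δ × (a ≡ 1 ⊎ b ≡ T)

IsAdmissible : ℕ → ℕ → Interval → Set
IsAdmissible Δ T I = IsWindow Δ T I ⊎ IsPartialWindow Δ T I

-- Consecutive intervals [a1,b1], [a2,b2] (b1 < a2) at distance exactly Δ-1,
-- i.e. a2 - b1 - 1 = Δ - 1, i.e. a2 = b1 + Δ (for Δ ≥ 1).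
AtDistance : ℕ → Interval → Interval → Set
AtDistance Δ (a₁ , b₁) (a₂ , b₂) = a₂ ≡ b₁ + Δ

-- A family of (partial) Δ-windows, listed in increasing order, any two
-- consecutive members being at distance exactly Δ-1.  (Every such family,
-- viewed as a set, has exactly one such increasing listing.)
IsChain : ℕ → ℕ → List Interval → Set
IsChain Δ T S = All (IsAdmissible Δ T) S × Linked (AtDistance Δ) S

IsTemplate : ℕ → ℕ → List Interval → Set
IsTemplate Δ T S =
  IsChain Δ T S × (∀ S′ → IsChain Δ T S′ → S ⊆ S′ → S′ ⊆ S)

Covers : List Interval → ℕ → Set
Covers S t = Any (λ I → proj₁ I ≤ t × t ≤ proj₂ I) S

HasExactly : {A : Set} → ℕ → (A → Set) → Set
HasExactly {A} n P =
  Σ (List A) λ L → Unique L × length L ≡ n × (∀ x → P x ⇔ x ∈ L)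

-- Write Δ = d + 1.  Every (partial) Δ-window is the window [e − d, e] clipped to [1, T], for a
-- unique "virtual end" e ∈ [1, T + d], and two clipped windows are at distance Δ − 1 exactly when
-- their virtual ends differ by 2Δ − 1.  A chain is therefore determined by its first window, and
-- a template is the image of a whole residue class of [1, T + d] modulo 2Δ − 1, which gives 2Δ − 1
-- templates.  Slot t lies in the clipped window with end e iff t ≤ e ≤ t + d, so the templates
-- covering t are those of the classes of t, t + 1, …, t + d: Δ distinct classes.
module Submission where

open import Defs
open import Data.Nat using (ℕ; _≤_; _∸_; _*_)
open import Data.Product using (_×_)

open import Data.Nat
  using ( zero; suc; _+_; _<_; _≮_; _⊔_; _⊓_; _/_; _%_; NonZero
        ; z≤n; s≤s; s≤s⁻¹; z<s; _≤?_; _<?_)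
open import Data.Nat.Properties
open import Data.Nat.DivMod using (m≡m%n+[m/n]*n; [m+kn]%n≡m%n; m<n⇒m%n≡m; m%n<n; /-monoˡ-≤)
open import Data.Product using (_,_; proj₁; proj₂; ∃-syntax)
open import Data.Sum using (inj₁; inj₂)
open import Data.List using (List; []; _∷_; _++_; map; applyUpTo)
open import Data.List.Properties using (++-identityʳ; length-applyUpTo; ∷-injectiveˡ)
open import Data.List.Membership.Propositional using (_∈_; _∉_; find; lose)
open import Data.List.Membership.Propositional.Properties
  using (∈-++⁺ˡ; ∈-++⁺ʳ; ∈-applyUpTo⁺; ∈-applyUpTo⁻; ∈-map⁺)
open import Data.List.Relation.Unary.All using (All; []; _∷_)
import Data.List.Relation.Unary.All as All
open import Data.List.Relation.Unary.AllPairs using (_∷_)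
import Data.List.Relation.Unary.AllPairs as AllPairs
open import Data.List.Relation.Unary.Any using (here; there)
import Data.List.Relation.Unary.Any.Properties as Any
open import Data.List.Relation.Unary.Linked using (Linked; []; [-]; _∷_)
open import Data.List.Relation.Unary.Linked.Properties using (Linked⇒AllPairs; Linked⇒All)
open import Data.List.Relation.Unary.Unique.Propositional using (Unique)
open import Data.List.Relation.Unary.Unique.Propositional.Properties using (Unique[x∷xs]⇒x∉xs)
import Data.List.Relation.Unary.Unique.Propositional.Properties as Unique
open import Data.List.Relation.Binary.Subset.Propositional using (_⊆_)
open import Function.Base using (_$_; _∘_)
open import Function.Bundles using (_⇔_; mk⇔; Equivalence)
open import Relation.Nullary using (yes; no; contradiction)
open import Relation.Binary.PropositionalEquality

hasExactly-applyUpTo : {A : Set} {P : A → Set} (f : ℕ → A) (n : ℕ) →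
                       (∀ {i j} → i < j → j < n → f i ≢ f j) →
                       (∀ x → P x ⇔ (∃[ i ] i < n × x ≡ f i)) →
                       HasExactly n P
hasExactly-applyUpTo f n f-distinct P⇔ =
  applyUpTo f n , Unique.applyUpTo⁺₁ f n f-distinct , length-applyUpTo f n ,
  λ x → mk⇔ (λ Px → ∈-image (Equivalence.to (P⇔ x) Px))
            (λ x∈ → Equivalence.from (P⇔ x) (∈-applyUpTo⁻ f x∈))
  where
  ∈-image : ∀ {x} → (∃[ i ] i < n × x ≡ f i) → x ∈ applyUpTo f n
  ∈-image (i , i<n , refl) = ∈-applyUpTo⁺ f i<n

unique-++⇒∉ : {A : Set} (xs : List A) {y : A} {ys : List A} → Unique (xs ++ y ∷ ys) → y ∉ xs
unique-++⇒∉ (x ∷ xs) (x∉ ∷ _) (here refl) = All.lookup x∉ (∈-++⁺ʳ xs (here refl)) refl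
unique-++⇒∉ (x ∷ xs) (_ ∷ unique) (there y∈xs) = unique-++⇒∉ xs unique y∈xs

ascending⇒head-least : ∀ {m k ks} → Linked _<_ (k ∷ ks) → m ∈ k ∷ ks → k ≤ m
ascending⇒head-least _ (here refl) = ≤-refl
ascending⇒head-least (k<k′ ∷ ascending) (there m∈ks) =
  <⇒≤ (All.lookup (Linked⇒All <-trans k<k′ ascending) m∈ks)

%-distinct : ∀ {a b} n .{{_ : NonZero n}} → a < b → b < a + n → a % n ≢ b % n
%-distinct {a} {b} n a<b b<a+n a%n≡b%n = <⇒≱ b<a+n a+n≤b
  where
  open ≤-Reasoning
  a/n<b/n : a / n < b / n
  a/n<b/n = ≤∧≢⇒< (/-monoˡ-≤ n (<⇒≤ a<b)) λ a/n≡b/n → <⇒≢ a<b (begin-equality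
    a                 ≡⟨ m≡m%n+[m/n]*n a n ⟩
    a % n + a / n * n ≡⟨ cong₂ (λ r k → r + k * n) a%n≡b%n a/n≡b/n ⟩
    b % n + b / n * n ≡⟨ m≡m%n+[m/n]*n b n ⟨
    b                 ∎)
  a+n≤b : a + n ≤ b
  a+n≤b = begin
    a + n                     ≡⟨ cong (_+ n) (m≡m%n+[m/n]*n a n) ⟩
    a % n + a / n * n + n     ≡⟨ cong (λ r → r + a / n * n + n) a%n≡b%n ⟩
    b % n + a / n * n + n     ≡⟨ +-assoc (b % n) (a / n * n) n ⟩
    b % n + (a / n * n + n)   ≡⟨ cong (b % n +_) (+-comm (a / n * n) n) ⟩
    b % n + suc (a / n) * n   ≤⟨ +-monoʳ-≤ (b % n) (*-monoˡ-≤ n a/n<b/n) ⟩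
    b % n + b / n * n         ≡⟨ m≡m%n+[m/n]*n b n ⟨
    b                         ∎

ClassMeetsWindow : (n q m w : ℕ) → Set
ClassMeetsWindow n q m w = ∃[ k ] m ≤ q + k * n × q + k * n ≤ m + w

classMeetsWindow⇔ : ∀ n .{{_ : NonZero n}} {q m w} → q < n →
                    ClassMeetsWindow n q m w ⇔ (∃[ j ] j ≤ w × q ≡ (m + j) % n)
classMeetsWindow⇔ n {q} {m} {w} q<n = mk⇔ to from
  where
  open ≡-Reasoning
  to : ClassMeetsWindow n q m w → ∃[ j ] j ≤ w × q ≡ (m + j) % n
  to (k , m≤e , e≤m+w) = e ∸ m , m≤n+o⇒m∸n≤o e m e≤m+w , (begin
    q                 ≡⟨ m<n⇒m%n≡m q<n ⟨
    q % n             ≡⟨ [m+kn]%n≡m%n q k n ⟨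
    e % n             ≡⟨ cong (_% n) (m+[n∸m]≡n m≤e) ⟨
    (m + (e ∸ m)) % n ∎)
    where e = q + k * n
  from : (∃[ j ] j ≤ w × q ≡ (m + j) % n) → ClassMeetsWindow n q m w
  from (j , j≤w , q≡) = (m + j) / n , subst (m ≤_) (sym e≡m+j) (m≤m+n m j) ,
                        subst (_≤ m + w) (sym e≡m+j) (+-monoʳ-≤ m j≤w)
    where
    e≡m+j : q + (m + j) / n * n ≡ m + j
    e≡m+j = trans (cong (λ r → r + (m + j) / n * n) q≡) (sym (m≡m%n+[m/n]*n (m + j) n))

m+2≤n+1+o⇔m<n+o : ∀ m n o → m + 2 ≤ n + suc o ⇔ m < n + o
m+2≤n+1+o⇔m<n+o m n o = mk⇔
  (λ le → s≤s⁻¹ (subst₂ _≤_ (+-comm m 2) (+-suc n o) le))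
  (λ lt → subst₂ _≤_ (+-comm 2 m) (sym (+-suc n o)) (s≤s lt))

m⊓n<n⇒m⊓n≡m : ∀ {m n} → m ⊓ n < n → m ⊓ n ≡ m
m⊓n<n⇒m⊓n≡m {m} {n} m⊓n<n with ⊓-sel m n
... | inj₁ m⊓n≡m = m⊓n≡m
... | inj₂ m⊓n≡n = contradiction (subst (_< n) m⊓n≡n m⊓n<n) (<-irrefl refl)

window-end : ∀ {a b d} → b + 1 ≡ a + suc d → b ≡ a + d
window-end {a} {b} {d} eq = suc-injective (trans (sym (+-comm b 1)) (trans eq (+-suc a d)))

module _ {d T : ℕ} where

  admissible-bounds : ∀ {a b} → IsAdmissible (suc d) T (a , b) → 1 ≤ a × a ≤ b × b ≤ T
  admissible-bounds {a} (inj₁ (1≤a , b+1≡a+Δ , b≤T)) =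
    1≤a , subst (a ≤_) (sym (window-end b+1≡a+Δ)) (m≤m+n a d) , b≤T
  admissible-bounds (inj₂ (1≤a , a≤b , b≤T , _)) = 1≤a , a≤b , b≤T

  chain⇒starts-ascending : ∀ {S} → IsChain (suc d) T S → Linked _<_ (map proj₁ S)
  chain⇒starts-ascending (_ , []) = []
  chain⇒starts-ascending (_ , [-]) = [-]
  chain⇒starts-ascending {(a , b) ∷ _} (adm ∷ adms , refl ∷ links) =
    ≤-<-trans (proj₁ (proj₂ (admissible-bounds adm))) (m<m+n b z<s) ∷
    chain⇒starts-ascending (adms , links)

  chain⇒unique : ∀ {S} → IsChain (suc d) T S → Unique S
  chain⇒unique chain =
    Unique.map⁻ (AllPairs.map <⇒≢ (Linked⇒AllPairs <-trans (chain⇒starts-ascending chain)))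

  chain-head : ∀ {I J S} → IsChain (suc d) T (J ∷ S) → I ∈ J ∷ S → proj₁ I ≤ suc d →
               I ≡ J
  chain-head _ (here refl) _ = refl
  chain-head {I} {J , b} {K ∷ S} chain@(adm ∷ _ , refl ∷ _) (there I∈K∷S) I≤Δ =
    contradiction (≤-trans K≤I I≤Δ) (<⇒≱ (+-monoˡ-≤ (suc d) 1≤b))
    where
    1≤b : 1 ≤ b
    1≤b = let (1≤J , J≤b , _) = admissible-bounds adm in ≤-trans 1≤J J≤b
    K≤I : proj₁ K ≤ proj₁ I
    K≤I with chain⇒starts-ascending chain
    ... | _ ∷ ascending = ascending⇒head-least ascending (∈-map⁺ proj₁ I∈K∷S)

module Templates (d T : ℕ) (d<T : d < T) where

  Δ : ℕ
  Δ = suc d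

  period : ℕ
  period = suc (d + d)

  period≡2*Δ∸1 : period ≡ 2 * Δ ∸ 1
  period≡2*Δ∸1 = trans (sym (+-suc d d)) (cong (d +_) (sym (+-identityʳ Δ)))

  1≤T : 1 ≤ T
  1≤T = ≤-trans (s≤s z≤n) d<T

  Admissible : Interval → Set
  Admissible = IsAdmissible Δ T

  clip : ℕ → Interval
  clip e = ((e ∸ d) ⊔ 1 , e ⊓ T)

  data EndView : ℕ → Set where
    early : ∀ {e} → e ≤ d → EndView e
    late  : ∀ {a} → 1 ≤ a → EndView (a + d)

  endView : ∀ e → EndView e
  endView e with e ≤? d
  ... | yes e≤d = early e≤d
  ... | no e≰d with o , refl ← m≤n⇒∃[o]m+o≡n (≰⇒> e≰d) =
    subst EndView (cong suc (+-comm o d)) (late {suc o} (s≤s z≤n))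

  clip-early : ∀ {e} → e ≤ d → clip e ≡ (1 , e)
  clip-early e≤d =
    cong₂ _,_ (cong (_⊔ 1) (m≤n⇒m∸n≡0 e≤d)) (m≤n⇒m⊓n≡m (≤-trans e≤d (<⇒≤ d<T)))

  clip-start : ∀ {a} → 1 ≤ a → proj₁ (clip (a + d)) ≡ a
  clip-start {a} 1≤a = trans (cong (_⊔ 1) (m+n∸n≡m a d)) (m≥n⇒m⊔n≡m 1≤a)

  clip-window : ∀ {a} → 1 ≤ a → a + d ≤ T → clip (a + d) ≡ (a , a + d)
  clip-window 1≤a a+d≤T = cong₂ _,_ (clip-start 1≤a) (m≤n⇒m⊓n≡m a+d≤T)

  clip-late : ∀ {a} → 1 ≤ a → T ≤ a + d → clip (a + d) ≡ (a , T)
  clip-late 1≤a T≤a+d = cong₂ _,_ (clip-start 1≤a) (m≥n⇒m⊓n≡n T≤a+d)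

  clip-admissible : ∀ {e} → 1 ≤ e → e ≤ T + d → Admissible (clip e)
  clip-admissible {e} 1≤e e≤T+d with endView e
  ... | early e≤d = subst Admissible (sym (clip-early e≤d)) $
    inj₂ (≤-refl , 1≤e , ≤-trans e≤d (<⇒≤ d<T) ,
          Equivalence.from (m+2≤n+1+o⇔m<n+o e 1 d) (s≤s e≤d) , inj₁ refl)
  ... | late {a} 1≤a with a + d ≤? T
  ...   | yes a+d≤T = subst Admissible (sym (clip-window 1≤a a+d≤T)) $
    inj₁ (1≤a , trans (+-assoc a d 1) (cong (a +_) (+-comm d 1)) , a+d≤T)
  ...   | no a+d≰T = subst Admissible (sym (clip-late 1≤a (<⇒≤ (≰⇒> a+d≰T)))) $
    inj₂ (1≤a , +-cancelʳ-≤ d a T e≤T+d , ≤-refl ,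
          Equivalence.from (m+2≤n+1+o⇔m<n+o T a d) (≰⇒> a+d≰T) , inj₂ refl)

  admissible⇒clip : ∀ {I} → Admissible I → ∃[ e ] 1 ≤ e × e ≤ T + d × I ≡ clip e
  admissible⇒clip {a , b} (inj₁ (1≤a , b+1≡a+Δ , b≤T)) rewrite window-end b+1≡a+Δ =
    a + d , ≤-trans 1≤a (m≤m+n a d) , ≤-trans b≤T (m≤m+n T d) , sym (clip-window 1≤a b≤T)
  admissible⇒clip {.1 , b} (inj₂ (_ , 1≤b , b≤T , b+2≤1+Δ , inj₁ refl)) =
    b , 1≤b , ≤-trans b≤T (m≤m+n T d) ,
    sym (clip-early (s≤s⁻¹ (Equivalence.to (m+2≤n+1+o⇔m<n+o b 1 d) b+2≤1+Δ)))
  admissible⇒clip {a , .T} (inj₂ (1≤a , a≤T , _ , T+2≤a+Δ , inj₂ refl)) =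
    a + d , ≤-trans 1≤a (m≤m+n a d) , +-monoˡ-≤ d a≤T ,
    sym (clip-late 1≤a (<⇒≤ (Equivalence.to (m+2≤n+1+o⇔m<n+o T a d) T+2≤a+Δ)))

  unclip : Interval → ℕ
  unclip (a , b) with b <? T
  ... | yes _ = b
  ... | no _ = a + d

  unclip-short : ∀ {a b} → b < T → unclip (a , b) ≡ b
  unclip-short {b = b} b<T with b <? T
  ... | yes _ = refl
  ... | no b≮T = contradiction b<T b≮T

  unclip-long : ∀ {a} → unclip (a , T) ≡ a + d
  unclip-long with T <? T
  ... | yes T<T = contradiction T<T (<-irrefl refl)
  ... | no _ = refl

  unclip-clip : ∀ e → unclip (clip e) ≡ e
  unclip-clip e with endView e
  ... | early e≤d = trans (cong unclip (clip-early e≤d)) (unclip-short (≤-<-trans e≤d d<T))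
  ... | late {a} 1≤a with a + d <? T
  ...   | yes a+d<T = trans (cong unclip (clip-window 1≤a (<⇒≤ a+d<T))) (unclip-short a+d<T)
  ...   | no a+d≮T = trans (cong unclip (clip-late 1≤a (≮⇒≥ a+d≮T))) unclip-long

  clip-injective : ∀ {e e′} → clip e ≡ clip e′ → e ≡ e′
  clip-injective {e} {e′} eq =
    trans (sym (unclip-clip e)) (trans (cong unclip eq) (unclip-clip e′))

  clip-start+d : ∀ e → 1 < proj₁ (clip e) → e ≡ proj₁ (clip e) + d
  clip-start+d e 1<start with endView e
  ... | early e≤d = contradiction (subst (1 <_) (cong proj₁ (clip-early e≤d)) 1<start) (<-irrefl refl)
  ... | late 1≤a = cong (_+ d) (sym (clip-start 1≤a))

  clip-start≤Δ : ∀ {e} → e ≤ period → proj₁ (clip e) ≤ Δ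
  clip-start≤Δ {e} e≤period =
    ⊔-lub (m≤n+o⇒m∸n≤o e d (subst (e ≤_) (sym (+-suc d d)) e≤period)) (s≤s z≤n)

  +period≡+Δ+d : ∀ e → e + period ≡ e + Δ + d
  +period≡+Δ+d e = sym (+-assoc e Δ d)

  +period≤⇒+Δ≤ : ∀ {e} → e + period ≤ T + d → e + Δ ≤ T
  +period≤⇒+Δ≤ {e} e+period≤T+d =
    +-cancelʳ-≤ d (e + Δ) T (subst (_≤ T + d) (+period≡+Δ+d e) e+period≤T+d)

  clip-next : ∀ {e} → e + period ≤ T + d → AtDistance Δ (clip e) (clip (e + period))
  clip-next {e} e+period≤T+d = begin
    proj₁ (clip (e + period)) ≡⟨ cong (proj₁ ∘ clip) (+period≡+Δ+d e) ⟩
    proj₁ (clip (e + Δ + d))  ≡⟨ clip-start (≤-trans (s≤s z≤n) (m≤n+m Δ e)) ⟩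
    e + Δ                     ≡⟨ cong (_+ Δ) (m≤n⇒m⊓n≡m e≤T) ⟨
    e ⊓ T + Δ                 ∎
    where
    open ≡-Reasoning
    e≤T : e ≤ T
    e≤T = ≤-trans (m≤m+n e Δ) (+period≤⇒+Δ≤ e+period≤T+d)

  next-after-clip : ∀ {e a b} → 1 ≤ e → Admissible (a , b) → AtDistance Δ (clip e) (a , b) →
                    e + period ≤ T + d × (a , b) ≡ clip (e + period)
  next-after-clip {e} {a} {b} 1≤e adm a≡e⊓T+Δ with admissible⇒clip adm
  ... | e′ , _ , e′≤T+d , ab≡clip-e′ =
    subst (_≤ T + d) e′≡e+period e′≤T+d , trans ab≡clip-e′ (cong clip e′≡e+period)
    where
    start≡a : proj₁ (clip e′) ≡ a
    start≡a = cong proj₁ (sym ab≡clip-e′)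
    1<a : 1 < a
    1<a = subst (1 <_) (sym a≡e⊓T+Δ)
                (≤-trans (s≤s (s≤s z≤n)) (+-monoˡ-≤ Δ (⊓-glb 1≤e 1≤T)))
    e′≡a+d : e′ ≡ a + d
    e′≡a+d = trans (clip-start+d e′ (subst (1 <_) (sym start≡a) 1<a)) (cong (_+ d) start≡a)
    a≤T : a ≤ T
    a≤T = +-cancelʳ-≤ d a T (subst (_≤ T + d) e′≡a+d e′≤T+d)
    e⊓T≡e : e ⊓ T ≡ e
    e⊓T≡e = m⊓n<n⇒m⊓n≡m (<-≤-trans (m<m+n (e ⊓ T) z<s) (subst (_≤ T) a≡e⊓T+Δ a≤T))
    e′≡e+period : e′ ≡ e + period
    e′≡e+period = begin
      e′            ≡⟨ e′≡a+d ⟩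
      a + d         ≡⟨ cong (_+ d) a≡e⊓T+Δ ⟩
      e ⊓ T + Δ + d ≡⟨ cong (λ x → x + Δ + d) e⊓T≡e ⟩
      e + Δ + d     ≡⟨ +period≡+Δ+d e ⟨
      e + period    ∎
      where open ≡-Reasoning

  _∈ᵢ_ : ℕ → Interval → Set
  t ∈ᵢ I = proj₁ I ≤ t × t ≤ proj₂ I

  ∈ᵢ-clip⇔ : ∀ {t e} → 1 ≤ t → t ≤ T → t ∈ᵢ clip e ⇔ (t ≤ e × e ≤ t + d)
  ∈ᵢ-clip⇔ {t} {e} 1≤t t≤T = mk⇔ to from
    where
    to : t ∈ᵢ clip e → t ≤ e × e ≤ t + d
    to (start≤t , t≤end) = ≤-trans t≤end (m⊓n≤m e T) , subst (e ≤_) (+-comm d t)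
      (≤-trans (m≤n+m∸n e d) (+-monoʳ-≤ d (m⊔n≤o⇒m≤o (e ∸ d) 1 start≤t)))
    from : t ≤ e × e ≤ t + d → t ∈ᵢ clip e
    from (t≤e , e≤t+d) =
      ⊔-lub (m≤n+o⇒m∸n≤o e d (subst (e ≤_) (+-comm t d) e≤t+d)) 1≤t , ⊓-glb t≤e t≤T

  -- The first argument is only fuel.
  progression : ℕ → ℕ → List ℕ
  progression zero e = []
  progression (suc n) e with e ≤? T + d
  ... | yes _ = e ∷ progression n (e + period)
  ... | no _ = []

  progression-suc : ∀ n {e} → e ≤ T + d → progression (suc n) e ≡ e ∷ progression n (e + period)
  progression-suc n {e} e≤T+d with e ≤? T + d
  ... | yes _ = refl
  ... | no e≰T+d = contradiction e≤T+d e≰T+d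

  fuel-exhausted : ∀ {e} → e ≤ T + d → T + d ≮ e + 0
  fuel-exhausted {e} e≤T+d fuel = <⇒≱ (subst (T + d <_) (+-identityʳ e) fuel) e≤T+d

  fuel-enough : ∀ e → T + d < e + suc (T + d)
  fuel-enough e = m≤n+m (suc (T + d)) e

  fuel-step : ∀ {e n} → T + d < e + suc n → T + d < e + period + n
  fuel-step {e} {n} fuel = ≤-trans fuel (subst (e + suc n ≤_) (sym (+-assoc e period n))
                                          (+-monoʳ-≤ e (+-monoˡ-≤ n (s≤s z≤n))))

  ∈-progression⁻ : ∀ n {e₀ e} → e ∈ progression n e₀ → ∃[ k ] e ≡ e₀ + k * period
  ∈-progression⁻ (suc n) {e₀} e∈ with e₀ ≤? T + d
  ∈-progression⁻ (suc n) {e₀} (here refl) | yes _ = 0 , sym (+-identityʳ e₀)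
  ∈-progression⁻ (suc n) {e₀} (there e∈) | yes _ with k , refl ← ∈-progression⁻ n e∈ =
    suc k , +-assoc e₀ period (k * period)

  ∈-progression⁺ : ∀ n k {e₀} → e₀ + k * period ≤ T + d → T + d < e₀ + n →
                   e₀ + k * period ∈ progression n e₀
  ∈-progression⁺ zero k {e₀} e≤T+d fuel =
    contradiction fuel (fuel-exhausted (≤-trans (m≤m+n e₀ (k * period)) e≤T+d))
  ∈-progression⁺ (suc n) k {e₀} e≤T+d fuel =
    subst (e₀ + k * period ∈_) (sym (progression-suc n (≤-trans (m≤m+n e₀ (k * period)) e≤T+d)))
          (∈-unfolded k e≤T+d)
    where
    ∈-unfolded : ∀ k → e₀ + k * period ≤ T + d →
                 e₀ + k * period ∈ e₀ ∷ progression n (e₀ + period)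
    ∈-unfolded zero _ = here (+-identityʳ e₀)
    ∈-unfolded (suc k) e≤T+d =
      there (subst (_∈ progression n (e₀ + period)) assoc
                   (∈-progression⁺ n k (subst (_≤ T + d) (sym assoc) e≤T+d) (fuel-step fuel)))
      where assoc = +-assoc e₀ period (k * period)

  clip-linked-cons : ∀ n {e} → Linked (AtDistance Δ) (map clip (progression n (e + period))) →
                     Linked (AtDistance Δ) (clip e ∷ map clip (progression n (e + period)))
  clip-linked-cons zero _ = [-]
  clip-linked-cons (suc n) {e} linked with e + period ≤? T + d
  ... | yes e+period≤T+d = clip-next e+period≤T+d ∷ linked
  ... | no _ = [-]

  progression-chain : ∀ n {e} → 1 ≤ e → IsChain Δ T (map clip (progression n e))
  progression-chain zero _ = [] , []
  progression-chain (suc n) {e} 1≤e with e ≤? T + d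
  ... | no _ = [] , []
  ... | yes e≤T+d with progression-chain n (≤-trans 1≤e (m≤m+n e period))
  ...   | admissible , linked = clip-admissible 1≤e e≤T+d ∷ admissible , clip-linked-cons n linked

  chain-prefix : ∀ n {e rest} → IsChain Δ T (clip e ∷ rest) → 1 ≤ e → e ≤ T + d →
                 T + d < e + n → ∃[ more ] map clip (progression n e) ≡ clip e ∷ rest ++ more
  chain-prefix zero _ _ e≤T+d fuel = contradiction fuel (fuel-exhausted e≤T+d)
  chain-prefix (suc n) {e} {[]} _ _ e≤T+d _ =
    map clip (progression n (e + period)) , cong (map clip) (progression-suc n e≤T+d)
  chain-prefix (suc n) {e} {(a , b) ∷ rest} (_ ∷ admissible , link ∷ links) 1≤e e≤T+d fuel
    with next-after-clip 1≤e (All.head admissible) link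
  ... | e+period≤T+d , refl
    with more , eq ← chain-prefix n (admissible , links) (≤-trans 1≤e (m≤m+n e period))
                                  e+period≤T+d (fuel-step fuel) =
    more , trans (cong (map clip) (progression-suc n e≤T+d)) (cong (clip e ∷_) eq)

  template : ℕ → List Interval
  template q = map clip (progression (suc (T + d)) (suc q))

  template-chain : ∀ q → IsChain Δ T (template q)
  template-chain q = progression-chain _ (s≤s z≤n)

  q<period⇒q<T+d : ∀ {q} → q < period → q < T + d
  q<period⇒q<T+d q<period = ≤-trans q<period (+-monoˡ-≤ d d<T)

  template-unfold : ∀ {q} → q < period →
                    template q ≡ clip (suc q) ∷ map clip (progression (T + d) (suc q + period))
  template-unfold q<period = cong (map clip) (progression-suc (T + d) (q<period⇒q<T+d q<period))

  template-prefix : ∀ {q rest} → IsChain Δ T (clip (suc q) ∷ rest) → q < T + d →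
                    ∃[ more ] template q ≡ clip (suc q) ∷ rest ++ more
  template-prefix {q} chain q<T+d = chain-prefix _ chain (s≤s z≤n) q<T+d (fuel-enough (suc q))

  template-injective : ∀ {q q′} → q < period → q′ < period →
                       template q ≡ template q′ → q ≡ q′
  template-injective q<period q′<period eq = suc-injective (clip-injective (∷-injectiveˡ
    (trans (sym (template-unfold q<period)) (trans eq (template-unfold q′<period)))))

  template-isTemplate : ∀ {q} → q < period → IsTemplate Δ T (template q)
  template-isTemplate {q} q<period = template-chain q , maximal
    where
    head∈ : clip (suc q) ∈ template q
    head∈ = subst (clip (suc q) ∈_) (sym (template-unfold q<period)) (here refl)
    maximal : ∀ S → IsChain Δ T S → template q ⊆ S → S ⊆ template q
    maximal [] _ template⊆S with () ← template⊆S head∈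
    maximal (J ∷ S) chain template⊆S
      with refl ← chain-head chain (template⊆S head∈) (clip-start≤Δ q<period)
      with more , eq ← template-prefix chain (q<period⇒q<T+d q<period) =
      λ I∈ → subst (_ ∈_) (sym eq) (∈-++⁺ˡ I∈)

  -- Otherwise clip (e ∸ period) could be put in front of the template.
  template-head≤period : ∀ {e rest} → IsTemplate Δ T (clip e ∷ rest) → e ≤ T + d → e ≤ period
  template-head≤period {e} {rest} ((admissible , links) , maximal) e≤T+d with e ≤? period
  ... | yes e≤period = e≤period
  ... | no e≰period = contradiction (maximal (clip e′ ∷ clip e ∷ rest) longer there (here refl))
                                    (Unique[x∷xs]⇒x∉xs (chain⇒unique longer))
    where
    period<e : period < e
    period<e = ≰⇒> e≰period
    e′ : ℕ
    e′ = e ∸ period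
    e′+period≡e : e′ + period ≡ e
    e′+period≡e = m∸n+n≡m (<⇒≤ period<e)
    longer : IsChain Δ T (clip e′ ∷ clip e ∷ rest)
    longer = clip-admissible (m<n⇒0<n∸m period<e) (≤-trans (m∸n≤m e period) e≤T+d) ∷ admissible ,
             subst (AtDistance Δ (clip e′) ∘ clip) e′+period≡e
                   (clip-next (subst (_≤ T + d) (sym e′+period≡e) e≤T+d)) ∷ links

  template-determined-by-head : ∀ {q rest} → IsTemplate Δ T (clip (suc q) ∷ rest) → q < T + d →
                                clip (suc q) ∷ rest ≡ template q
  template-determined-by-head {q} {rest} (chain , maximal) q<T+d with template-prefix chain q<T+d
  ... | [] , eq = sym (trans eq (++-identityʳ _))
  ... | m ∷ more , eq =
    contradiction m∈S (unique-++⇒∉ S (subst Unique eq (chain⇒unique (template-chain q))))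
    where
    S = clip (suc q) ∷ rest
    m∈S : m ∈ S
    m∈S = maximal (template q) (template-chain q) (λ I∈ → subst (_ ∈_) (sym eq) (∈-++⁺ˡ I∈))
                  (subst (m ∈_) (sym eq) (∈-++⁺ʳ S (here refl)))

  template-complete : ∀ {S} → IsTemplate Δ T S → ∃[ q ] q < period × S ≡ template q
  template-complete {[]} (_ , maximal)
    with () ← maximal (clip 1 ∷ []) (clip-admissible ≤-refl (≤-trans 1≤T (m≤m+n T d)) ∷ [] , [-])
                      (λ ()) (here refl)
  template-complete {_ ∷ _} isTemplate@((admissible ∷ _ , _) , _) with admissible⇒clip admissible
  ... | suc q , _ , q<T+d , refl =
    q , template-head≤period isTemplate q<T+d , template-determined-by-head isTemplate q<T+d

  template-covers⇔ : ∀ {q t′} → t′ < T →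
                     Covers (template q) (suc t′) ⇔ ClassMeetsWindow period q t′ d
  template-covers⇔ {q} {t′} t′<T = mk⇔ to from
    where
    to : Covers (template q) (suc t′) → ClassMeetsWindow period q t′ d
    to covers with e , e∈ , t∈clip-e ← find (Any.map⁻ covers)
              with k , refl ← ∈-progression⁻ _ e∈
              with t≤e , e≤t+d ← Equivalence.to (∈ᵢ-clip⇔ (s≤s z≤n) t′<T) t∈clip-e =
      k , s≤s⁻¹ t≤e , s≤s⁻¹ e≤t+d
    from : ClassMeetsWindow period q t′ d → Covers (template q) (suc t′)
    from (k , t′≤ , ≤t′+d) = Any.map⁺ (lose
      (∈-progression⁺ _ k (≤-trans (s≤s ≤t′+d) (+-monoˡ-≤ d t′<T)) (fuel-enough (suc q)))
      (Equivalence.from (∈ᵢ-clip⇔ (s≤s z≤n) t′<T) (s≤s t′≤ , s≤s ≤t′+d)))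

  templates-count : HasExactly period (IsTemplate Δ T)
  templates-count = hasExactly-applyUpTo template period
    (λ q<q′ q′<period → <⇒≢ q<q′ ∘ template-injective (<-trans q<q′ q′<period) q′<period)
    (λ S → mk⇔ template-complete λ { (q , q<period , refl) → template-isTemplate q<period })

  covering-templates-count : ∀ {t} → 1 ≤ t → t ≤ T →
                             HasExactly Δ (λ S → IsTemplate Δ T S × Covers S t)
  covering-templates-count {suc t′} _ t≤T = hasExactly-applyUpTo (template ∘ class) Δ distinct
    (λ S → mk⇔ to λ { (j , j<Δ , refl) → from j<Δ })
    where
    class : ℕ → ℕ
    class j = (t′ + j) % period
    class<period : ∀ j → class j < period
    class<period j = m%n<n (t′ + j) period
    distinct : ∀ {i j} → i < j → j < Δ → template (class i) ≢ template (class j)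
    distinct {i} {j} i<j j<Δ = %-distinct period (+-monoʳ-< t′ i<j) t′+j<t′+i+period
                             ∘ template-injective (class<period i) (class<period j)
      where
      t′+j<t′+i+period : t′ + j < t′ + i + period
      t′+j<t′+i+period = subst (t′ + j <_) (sym (+-assoc t′ i period))
        (+-monoʳ-< t′ (≤-trans j<Δ (≤-trans (m≤m+n Δ d) (m≤n+m period i))))
    to : ∀ {S} → IsTemplate Δ T S × Covers S (suc t′) → ∃[ j ] j < Δ × S ≡ template (class j)
    to (isTemplate , covers) with q , q<period , refl ← template-complete isTemplate
      with j , j≤d , q≡class-j ← Equivalence.to (classMeetsWindow⇔ period q<period)
                                                (Equivalence.to (template-covers⇔ t≤T) covers) =
      j , s≤s j≤d , cong template q≡class-j
    from : ∀ {j} → j < Δ →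
           IsTemplate Δ T (template (class j)) × Covers (template (class j)) (suc t′)
    from {j} j<Δ = template-isTemplate (class<period j) ,
      Equivalence.from (template-covers⇔ t≤T)
        (Equivalence.from (classMeetsWindow⇔ period (class<period j)) (j , s≤s⁻¹ j<Δ , refl))

lemma4p2 : (Δ T : ℕ) → 1 ≤ Δ → Δ ≤ T →
    HasExactly (2 * Δ ∸ 1) (IsTemplate Δ T)
    × (∀ t → 1 ≤ t → t ≤ T →
         HasExactly Δ (λ S → IsTemplate Δ T S × Covers S t))
lemma4p2 (suc d) T _ Δ≤T =
  subst (λ n → HasExactly n (IsTemplate (suc d) T)) period≡2*Δ∸1 templates-count ,
  λ _ → covering-templates-count
  where open Templates d T Δ≤T
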